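{- Let $\mathcal{F}$ be a closure system on a finite set $X$ with closure operator $\phi$, let $A\in\mathcal{F}$, $A\neq X$, be meet-irreducible in $\mathcal{F}$ with unique upper cover $A^*$ in $\mathcal{F}$, write $A^*\setminus A=\{d_1,\dots,d_k\}$, and let $Y_1,\dots,Y_t$ be the minimal transversals of the hypergraph $H=\langle A,\mathcal{T}\rangle$. If $Y\rightarrow d$ is any implication that holds on every member of $\mathcal{F}^*=\mathcal{F}\setminus\{A\}$ and fails on $A$, then $Y_j\subseteq Y$ for some $j\le t$ and $d=d_i$ for some $i\le k$.
   Context: A closure system on $X$ is a family of subsets of $X$ containing $X$ and closed under intersections. $A\in\mathcal{F}$ is meet-irreducible if $A=B\cap C$ with $B,C\in\mathcal{F}$ implies $B=A$ or $C=A$; for $A\neq X$ this means $A$ has a unique upper cover $A^*$ in $(\mathcal{F},\subseteq)$. An implication $Y\rightarrow d$ ($Y\subseteq X$, $d\in X$) holds on a set $Z$ if $Y\not\subseteq Z$ or $d\in Z$, and fails otherwise. A hypergraph is a pair $\langle B,\mathcal{B}\rangle$ with $\mathcal{B}\subseteq 2^B$; $U\subseteq B$ is a transversal if $U\cap V\neq\emptyset$ for all $V\in\mathcal{B}$, minimal transversals being those minimal under inclusion. Here $\mathcal{T}=\{A\setminus\phi(A'):A'\subseteq A,\ \phi(A')\neq A\}$, i.e. the complements in $A$ of the members of $\mathcal{F}$ properly contained in $A$. -}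

module Defs where

open import Data.Nat using (ℕ)
open import Data.Fin using (Fin)
open import Data.Fin.Subset using (Subset; _∈_; _∉_; _⊆_; _⊂_; _∩_; _─_; ⊤; Nonempty)
open import Data.Product using (Σ; ∃; _×_)
open import Relation.Binary.PropositionalEquality using (_≡_; _≢_)
open import Relation.Nullary using (¬_)
open import Level using (0ℓ)

Family : ℕ → Set₁
Family n = Subset n → Set

module _ {n : ℕ} where

  -- closure system: contains X, closed under (binary, hence all finite) intersections
  record IsClosureSystem (𝓕 : Family n) : Set where
    field
      has-top : 𝓕 ⊤
      ∩-closed : ∀ B C → 𝓕 B → 𝓕 C → 𝓕 (B ∩ C)

  -- C = φ(Z): the least member of 𝓕 containing Z (closure operator of 𝓕)
  IsClosureOf : Family n → Subset n → Subset n → Set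
  IsClosureOf 𝓕 Z C = 𝓕 C × Z ⊆ C × (∀ D → 𝓕 D → Z ⊆ D → C ⊆ D)

  MeetIrreducible : Family n → Subset n → Set
  MeetIrreducible 𝓕 A = 𝓕 A × (∀ B C → 𝓕 B → 𝓕 C → A ≡ B ∩ C → (B ≡ A) Data.Sum.⊎ (C ≡ A))
    where import Data.Sum

  IsUpperCover : Family n → Subset n → Subset n → Set
  IsUpperCover 𝓕 A U = 𝓕 U × A ⊂ U × (∀ D → 𝓕 D → A ⊂ D → D ⊆ U → D ≡ U)

  IsUniqueUpperCover : Family n → Subset n → Subset n → Set
  IsUniqueUpperCover 𝓕 A A* = IsUpperCover 𝓕 A A* × (∀ U → IsUpperCover 𝓕 A U → U ≡ A*)

  InT : Family n → Subset n → Subset n → Set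
  InT 𝓕 A V = ∃ λ A' → ∃ λ C → A' ⊆ A × IsClosureOf 𝓕 A' C × C ≢ A × V ≡ A ─ C

  IsTransversal : Family n → Subset n → Subset n → Set
  IsTransversal 𝓕 A U = U ⊆ A × (∀ V → InT 𝓕 A V → Nonempty (U ∩ V))

  IsMinimalTransversal : Family n → Subset n → Subset n → Set
  IsMinimalTransversal 𝓕 A U =
    IsTransversal 𝓕 A U × (∀ W → W ⊆ U → IsTransversal 𝓕 A W → W ≡ U)

  HoldsOn : Subset n → Fin n → Subset n → Set
  HoldsOn Y d Z = Y ⊆ Z → d ∈ Z

  FailsOn : Subset n → Fin n → Subset n → Set
  FailsOn Y d Z = Y ⊆ Z × d ∉ Z

-- Y ⊆ A because Y → d fails on A.  If some closed C ⊊ A contained Y, the implication would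
-- hold on C and put d into C ⊆ A, contradicting d ∉ A; so Y lies in no proper closed subset
-- of A, which is exactly to say that Y meets every A ∖ φ(A') ∈ 𝓣.  As Subset n is finite and
-- being a transversal is decidable, Y contains a minimal transversal.  Finally A* ≠ A is
-- closed and contains Y, so d ∈ A*.
module Submission where

open import Defs
open import Data.Nat using (ℕ)
open import Data.Fin using (Fin)
open import Data.Fin.Properties using (any?)
open import Data.Fin.Subset using (Subset; _∈_; _∉_; _⊆_; _⊈_; _⊂_; _─_; ⊤; inside; outside)
open import Data.Fin.Subset.Properties
  using (_∈?_; _⊆?_; _⊂?_; anySubset?; x∈p∩q⁺; x∈p∩q⁻; x∈p∧x∉q⇒x∈p─q; ⊆-antisym; ⊂-irref)
open import Data.Fin.Subset.Induction using (⊂-wellFounded; Acc; acc)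
open import Data.Vec using (_∷_; here; there)
open import Data.Vec.Properties using (≡-dec)
open import Data.Bool.Properties using () renaming (_≟_ to _≟ᵇ_)
open import Data.Product using (∃; _×_; _,_; proj₁)
open import Data.Empty using (⊥-elim)
open import Level using (0ℓ)
open import Relation.Binary.PropositionalEquality using (_≡_; _≢_; refl; sym)
open import Relation.Unary using (Pred; Decidable)
open import Relation.Nullary using (¬_; yes; no; ¬?; _×-dec_)
open import Relation.Nullary.Decidable using (map′)

x∈p─q⇒x∉q : ∀ {n} {x : Fin n} (p q : Subset n) → x ∈ p ─ q → x ∉ q
x∈p─q⇒x∉q (inside  ∷ p) (inside ∷ q) ()        here
x∈p─q⇒x∉q (outside ∷ p) (inside ∷ q) ()        here
x∈p─q⇒x∉q (_       ∷ p) (_      ∷ q) (there x) (there y) = x∈p─q⇒x∉q p q x y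

⊈⇒∃∈∉ : ∀ {n} {p q : Subset n} → p ⊈ q → ∃ λ x → x ∈ p × x ∉ q
⊈⇒∃∈∉ {p = p} {q} p⊈q with any? (λ x → x ∈? p ×-dec ¬? (x ∈? q))
... | yes witness = witness
... | no none     = ⊥-elim (p⊈q p⊆q)
  where
  p⊆q : p ⊆ q
  p⊆q {x} x∈p with x ∈? q
  ... | yes x∈q = x∈q
  ... | no  x∉q = ⊥-elim (none (x , x∈p , x∉q))

module _ {n : ℕ} (P : Pred (Subset n) 0ℓ) (P? : Decidable P) where

  MinimalWith : Subset n → Set
  MinimalWith W = P W × (∀ V → V ⊆ W → P V → V ≡ W)

  ∃-minimal-⊆ : ∀ U → P U → ∃ λ W → MinimalWith W × W ⊆ U
  ∃-minimal-⊆ U = go U (⊂-wellFounded U)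
    where
    go : ∀ U → Acc _⊂_ U → P U → ∃ λ W → MinimalWith W × W ⊆ U
    go U (acc below) PU with anySubset? (λ V → V ⊂? U ×-dec P? V)
    ... | yes (V , V⊂U , PV) =
      let (W , minW , W⊆V) = go V (below V⊂U) PV in W , minW , λ x∈W → proj₁ V⊂U (W⊆V x∈W)
    ... | no noSmaller = U , (PU , minimal) , λ x∈U → x∈U
      where
      minimal : ∀ V → V ⊆ U → P V → V ≡ U
      minimal V V⊆U PV = ⊆-antisym V⊆U U⊆V
        where
        U⊆V : U ⊆ V
        U⊆V {x} x∈U with x ∈? V
        ... | yes x∈V = x∈V
        ... | no  x∉V = ⊥-elim (noSmaller (V , (V⊆U , x , x∈U , x∉V) , PV))

module _ {n : ℕ} (𝓕 : Family n) (A : Subset n) where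

  EscapesProperClosedSubsets : Subset n → Set
  EscapesProperClosedSubsets U = U ⊆ A × (∀ C → 𝓕 C → C ⊆ A → C ≢ A → U ⊈ C)

  transversal⇒escapes : ∀ U → IsTransversal 𝓕 A U → EscapesProperClosedSubsets U
  transversal⇒escapes U (U⊆A , meets) = U⊆A , λ C FC C⊆A C≢A U⊆C →
    let (x , x∈U∩A─C)  = meets (A ─ C)
                               (C , C , C⊆A , (FC , (λ x∈C → x∈C) , λ _ _ C⊆D → C⊆D) , C≢A , refl)
        (x∈U , x∈A─C)  = x∈p∩q⁻ U (A ─ C) x∈U∩A─C
    in x∈p─q⇒x∉q A C x∈A─C (U⊆C x∈U)

  escapes⇒transversal : 𝓕 A → ∀ U → EscapesProperClosedSubsets U → IsTransversal 𝓕 A U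
  escapes⇒transversal FA U (U⊆A , escapes) = U⊆A , λ where
    _ (A' , C , A'⊆A , (FC , _ , least) , C≢A , refl) →
      let (x , x∈U , x∉C) = ⊈⇒∃∈∉ (escapes C FC (least A FA A'⊆A) C≢A)
      in x , x∈p∩q⁺ (x∈U , x∈p∧x∉q⇒x∈p─q (U⊆A x∈U) x∉C)

  escapes? : Decidable 𝓕 → Decidable EscapesProperClosedSubsets
  escapes? 𝓕? U = U ⊆? A ×-dec map′ to from (¬? (anySubset? containsU?))
    where
    ContainsU : Subset n → Set
    ContainsU C = 𝓕 C × C ⊆ A × C ≢ A × U ⊆ C

    containsU? : Decidable ContainsU
    containsU? C = 𝓕? C ×-dec C ⊆? A ×-dec ¬? (≡-dec _≟ᵇ_ C A) ×-dec U ⊆? C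

    to : ¬ ∃ ContainsU → ∀ C → 𝓕 C → C ⊆ A → C ≢ A → U ⊈ C
    to none C FC C⊆A C≢A U⊆C = none (C , FC , C⊆A , C≢A , U⊆C)

    from : (∀ C → 𝓕 C → C ⊆ A → C ≢ A → U ⊈ C) → ¬ ∃ ContainsU
    from escapes (C , FC , C⊆A , C≢A , U⊆C) = escapes C FC C⊆A C≢A U⊆C

  transversal? : Decidable 𝓕 → 𝓕 A → Decidable (IsTransversal 𝓕 A)
  transversal? 𝓕? FA U = map′ (escapes⇒transversal FA U) (transversal⇒escapes U) (escapes? 𝓕? U)

  ∃-minimalTransversal-⊆ : Decidable 𝓕 → 𝓕 A → ∀ U → IsTransversal 𝓕 A U →
                           ∃ λ W → IsMinimalTransversal 𝓕 A W × W ⊆ U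
  ∃-minimalTransversal-⊆ 𝓕? FA = ∃-minimal-⊆ (IsTransversal 𝓕 A) (transversal? 𝓕? FA)

mainTheorem9 : (n : ℕ) (𝓕 : Family n) → Decidable 𝓕 → IsClosureSystem 𝓕 →
    (A A* : Subset n) → 𝓕 A → A ≢ ⊤ → MeetIrreducible 𝓕 A →
    IsUniqueUpperCover 𝓕 A A* →
    (Y : Subset n) (d : Fin n) →
    (∀ Z → 𝓕 Z → Z ≢ A → HoldsOn Y d Z) → FailsOn Y d A →
    (∃ λ Yj → IsMinimalTransversal 𝓕 A Yj × Yj ⊆ Y) × (d ∈ A* × d ∉ A)
mainTheorem9 n 𝓕 𝓕? _ A A* FA _ _ ((FA* , A⊂A* , _) , _) Y d holds (Y⊆A , d∉A) =
  ∃-minimalTransversal-⊆ 𝓕 A 𝓕? FA Y Y-transversal , d∈A* , d∉A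
  where
  Y-transversal : IsTransversal 𝓕 A Y
  Y-transversal = escapes⇒transversal 𝓕 A FA Y
    (Y⊆A , λ C FC C⊆A C≢A Y⊆C → d∉A (C⊆A (holds C FC C≢A Y⊆C)))

  d∈A* : d ∈ A*
  d∈A* = holds A* FA* (λ A*≡A → ⊂-irref (sym A*≡A) A⊂A*) (λ y∈Y → proj₁ A⊂A* (Y⊆A y∈Y))
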